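{- Let $\Pi_q$ be a projective plane of order $q$ and $r$ a positive integer. If $\Pi_q$ contains a set of $k\ge 2r$ lines in general position, then $m_r(\Pi_q)=\binom{r+1}{2}$.
   Context: A finite projective plane $\Pi_q$ of order $q\ge 2$ has $q^2+q+1$ points and $q^2+q+1$ lines; every line contains $q+1$ points, every point lies on $q+1$ lines, any two lines meet in exactly one point and any two points lie on exactly one line. $r$-neighbor line percolation: for a set $A$ of points let $A^0=A$ and for $s\ge1$ let $A^s=A^{s-1}\cup\{P: \exists \text{ line } l\ni P \text{ with } |l\cap A^{s-1}|\ge r\}$; $A$ percolates if $A^k$ equals the whole point set for some $k$. $m_r(\Pi_q)$ is the minimum size of a percolating set. A set of lines is in general position if no three of them pass through a common point. -}

module Defs where

open import Data.Nat using (ℕ; zero; suc; _+_; _*_; _≤_; _≥_)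
open import Data.Bool using (Bool; true; false; _∧_; _∨_; if_then_else_; T?)
open import Data.Fin using (Fin; zero; suc)
open import Data.Fin.Properties using (any?)
open import Data.Vec.Functional using (Vector)
open import Data.Product using (Σ; ∃; ∃-syntax; _×_; _,_)
open import Data.Nat using (_≤ᵇ_)
open import Relation.Binary.PropositionalEquality using (_≡_; _≢_)
open import Relation.Nullary.Decidable using (⌊_⌋)

count : {n : ℕ} → (Fin n → Bool) → ℕ
count {zero}  f = 0
count {suc n} f = (if f zero then 1 else 0) + count {n} (λ i → f (suc i))

record ProjectivePlane (q : ℕ) : Set where
  field
    inc : Fin (q * q + q + 1) → Fin (q * q + q + 1) → Bool
    line-size  : ∀ l → count (λ P → inc P l) ≡ q + 1
    point-deg  : ∀ P → count (λ l → inc P l) ≡ q + 1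
    lines-meet : ∀ l m → l ≢ m → count (λ P → inc P l ∧ inc P m) ≡ 1
    points-join : ∀ P Q → P ≢ Q → count (λ l → inc P l ∧ inc Q l) ≡ 1

module _ {q : ℕ} (Π : ProjectivePlane q) where
  open ProjectivePlane Π

  Pt : Set
  Pt = Fin (q * q + q + 1)

  Ln : Set
  Ln = Fin (q * q + q + 1)

  PointSet : Set
  PointSet = Pt → Bool

  meetCount : PointSet → Ln → ℕ
  meetCount A l = count (λ P → inc P l ∧ A P)

  step : ℕ → PointSet → PointSet
  step r A P = A P ∨ ⌊ any? (λ l → T? (inc P l ∧ (r ≤ᵇ meetCount A l))) ⌋

  iterate : ℕ → ℕ → PointSet → PointSet
  iterate r zero    A = A
  iterate r (suc s) A = step r (iterate r s A)

  Percolates : ℕ → PointSet → Set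
  Percolates r A = ∃[ k ] (∀ P → iterate r k A P ≡ true)

  IsMinPercolatingSize : ℕ → ℕ → Set
  IsMinPercolatingSize r n =
    (∃[ A ] (Percolates r A × count A ≡ n)) ×
    (∀ A → Percolates r A → n ≤ count A)

  GeneralPosition : (k : ℕ) → (Fin k → Ln) → Set
  GeneralPosition k L =
    (∀ i j → L i ≡ L j → i ≡ j) ×
    (∀ i j m → i ≢ j → j ≢ m → i ≢ m → ∀ P →
       inc P (L i) ∧ inc P (L j) ∧ inc P (L m) ≡ false)

module Submission where

-- Lower bound. Let A percolate. Choose lines ℓ₁, ℓ₂, … one at a time so that ℓᵢ₊₁ has at least r
-- points in A ∪ ℓ₁ ∪ … ∪ ℓᵢ; it then carries at least r − i points of A off the earlier lines.
-- Such a line exists while i < r: otherwise A ∪ ℓ₁ ∪ … ∪ ℓᵢ is closed under the percolation step,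
-- hence is the whole plane, and then every line other than ℓ₁, …, ℓᵢ has q + 1 ≥ r points in it.
-- Summing, |A| ≥ r + (r − 1) + … + 1 = C(r+1, 2).
--
-- Upper bound. Take r + 1 of the lines in general position and let A be the C(r+1, 2) points where
-- two of them meet. Each of these r + 1 lines carries r points of A and is infected at once; every
-- other line of the family meets them in r + 1 distinct points; finally, a line through any
-- remaining point meets the k ≥ 2r lines of the family, no three of them concurrent, in at least
-- r infected points.

open import Defs
open import Data.Nat using (ℕ; zero; suc; _+_; _*_; _≤_; _<_; _≥_; z≤n; s≤s; s≤s⁻¹; _≤ᵇ_; _≤?_)
open import Data.Nat.Properties hiding (suc-injective; _≟_)
open import Data.Nat.Combinatorics using (_C_; nC1≡n; nCk+nC[k+1]≡[n+1]C[k+1])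
open import Algebra.Properties.Semiring.Sum +-*-semiring
  using (sum; sum-syntax; sum-cong-≗; ∑-comm; ∑-distrib-+; *-distribˡ-sum)
open import Data.Bool using (Bool; true; false; _∧_; _∨_; not; if_then_else_; T; T?)
open import Data.Bool.Properties using (T-≡; T-∧; ∨-zeroʳ; ∧-identityʳ)
open import Data.Empty using (⊥)
open import Data.Fin using (Fin; zero; suc; inject≤; punchIn)
open import Data.Fin.Properties
  using (any?; all?; _≟_; suc-injective; inject≤-injective; punchIn-injective; punchInᵢ≢i; injective⇒≤)
open import Data.Product using (∃-syntax; _×_; _,_; proj₁; proj₂)
open import Data.Sum using (_⊎_; inj₁; inj₂)
open import Data.Vec.Functional using (_∷_)
open import Function using (_∘_; Equivalence)
open import Function.Definitions using (Injective)
open import Relation.Nullary using (¬_; yes; no; contradiction; ¬?; _×-dec_)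
open import Relation.Nullary.Decidable using (fromWitness)
open import Relation.Binary.PropositionalEquality

𝟙 : Bool → ℕ
𝟙 b = if b then 1 else 0

count≡∑ : ∀ {n} (f : Fin n → Bool) → count f ≡ ∑[ i < n ] 𝟙 (f i)
count≡∑ {zero}  f = refl
count≡∑ {suc n} f = cong (𝟙 (f zero) +_) (count≡∑ (f ∘ suc))

∑-mono-≤ : ∀ {n} {a b : Fin n → ℕ} → (∀ i → a i ≤ b i) → sum a ≤ sum b
∑-mono-≤ {zero}  _   = z≤n
∑-mono-≤ {suc n} a≤b = +-mono-≤ (a≤b zero) (∑-mono-≤ (a≤b ∘ suc))

∑-const-1 : ∀ n → ∑[ i < n ] 1 ≡ n
∑-const-1 zero    = refl
∑-const-1 (suc n) = cong suc (∑-const-1 n)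

count-cong : ∀ {n} {f g : Fin n → Bool} → (∀ i → f i ≡ g i) → count f ≡ count g
count-cong {zero}  _   = refl
count-cong {suc n} f≗g = cong₂ _+_ (cong 𝟙 (f≗g zero)) (count-cong (f≗g ∘ suc))

count-none : ∀ {n} {f : Fin n → Bool} → (∀ i → f i ≡ false) → count f ≡ 0
count-none {n} {f} none = trans (count-cong none) (count-false n)
  where
  count-false : ∀ n → count {n} (λ _ → false) ≡ 0
  count-false zero    = refl
  count-false (suc n) = count-false n

count-mono : ∀ {n} {f g : Fin n → Bool} → (∀ i → f i ≡ true → g i ≡ true) → count f ≤ count g
count-mono {n} {f} {g} f⊆g = begin
  count f              ≡⟨ count≡∑ f ⟩
  ∑[ i < n ] 𝟙 (f i)   ≤⟨ ∑-mono-≤ (λ i → 𝟙-mono (f⊆g i)) ⟩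
  ∑[ i < n ] 𝟙 (g i)   ≡⟨ count≡∑ g ⟨
  count g              ∎
  where
  open ≤-Reasoning
  𝟙-mono : ∀ {a b} → (a ≡ true → b ≡ true) → 𝟙 a ≤ 𝟙 b
  𝟙-mono {false} _   = z≤n
  𝟙-mono {true}  a⇒b rewrite a⇒b refl = ≤-refl

count-+-≡ : ∀ {n} (f g h : Fin n → Bool) → (∀ i → 𝟙 (h i) ≡ 𝟙 (f i) + 𝟙 (g i)) →
  count h ≡ count f + count g
count-+-≡ {n} f g h split = begin
  count h                                     ≡⟨ count≡∑ h ⟩
  ∑[ i < n ] 𝟙 (h i)                          ≡⟨ sum-cong-≗ split ⟩
  ∑[ i < n ] (𝟙 (f i) + 𝟙 (g i))              ≡⟨ ∑-distrib-+ (𝟙 ∘ f) (𝟙 ∘ g) ⟩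
  ∑[ i < n ] 𝟙 (f i) + ∑[ i < n ] 𝟙 (g i)     ≡⟨ cong₂ _+_ (count≡∑ f) (count≡∑ g) ⟨
  count f + count g                           ∎
  where
  open ≡-Reasoning

count-+-≤ : ∀ {n} (f g h : Fin n → Bool) → (∀ i → 𝟙 (h i) ≤ 𝟙 (f i) + 𝟙 (g i)) →
  count h ≤ count f + count g
count-+-≤ {n} f g h split = begin
  count h                                     ≡⟨ count≡∑ h ⟩
  ∑[ i < n ] 𝟙 (h i)                          ≤⟨ ∑-mono-≤ split ⟩
  ∑[ i < n ] (𝟙 (f i) + 𝟙 (g i))              ≡⟨ ∑-distrib-+ (𝟙 ∘ f) (𝟙 ∘ g) ⟩
  ∑[ i < n ] 𝟙 (f i) + ∑[ i < n ] 𝟙 (g i)     ≡⟨ cong₂ _+_ (count≡∑ f) (count≡∑ g) ⟨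
  count f + count g                           ∎
  where open ≤-Reasoning

count-swap : ∀ {m n} (h : Fin m → Fin n → Bool) →
  ∑[ i < m ] count (h i) ≡ ∑[ x < n ] count (λ i → h i x)
count-swap {m} {n} h = begin
  ∑[ i < m ] count (h i)                 ≡⟨ sum-cong-≗ (λ i → count≡∑ (h i)) ⟩
  ∑[ i < m ] ∑[ x < n ] 𝟙 (h i x)        ≡⟨ ∑-comm (λ i x → 𝟙 (h i x)) ⟩
  ∑[ x < n ] ∑[ i < m ] 𝟙 (h i x)        ≡⟨ sum-cong-≗ (λ x → count≡∑ (λ i → h i x)) ⟨
  ∑[ x < n ] count (λ i → h i x)         ∎
  where open ≡-Reasoning

count-pos : ∀ {n} {f : Fin n → Bool} {i} → f i ≡ true → 1 ≤ count f
count-pos {i = zero} fi rewrite fi = s≤s z≤n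
count-pos {f = f} {suc i} fi = ≤-trans (count-pos {f = f ∘ suc} fi) (m≤n+m _ (𝟙 (f zero)))

count-pair : ∀ {n} {f : Fin n → Bool} {i j} → i ≢ j → f i ≡ true → f j ≡ true → 2 ≤ count f
count-pair {i = zero} {zero} i≢j _ _ = contradiction refl i≢j
count-pair {f = f} {zero}  {suc j} _ fi fj rewrite fi = s≤s (count-pos {f = f ∘ suc} fj)
count-pair {f = f} {suc i} {zero}  _ fi fj rewrite fj = s≤s (count-pos {f = f ∘ suc} fi)
count-pair {f = f} {suc i} {suc j} i≢j fi fj =
  ≤-trans (count-pair {f = f ∘ suc} (i≢j ∘ cong suc) fi fj) (m≤n+m _ (𝟙 (f zero)))

zero∷suc∘-injective : ∀ {c n} {g : Fin c → Fin n} → Injective _≡_ _≡_ g →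
  Injective _≡_ _≡_ (zero ∷ suc ∘ g)
zero∷suc∘-injective g-inj {zero}  {zero}  _  = refl
zero∷suc∘-injective g-inj {suc x} {suc y} eq = cong suc (g-inj (suc-injective eq))

count≥⇒embedding : ∀ {n} c (f : Fin n → Bool) → c ≤ count f →
  ∃[ g ] (Injective _≡_ _≡_ g × ∀ (x : Fin c) → f (g x) ≡ true)
count≥⇒embedding zero f _ = (λ ()) , (λ { {()} }) , (λ ())
count≥⇒embedding {suc n} (suc c) f c<count with f zero in f₀
... | true  = let (g , g-inj , on) = count≥⇒embedding c (f ∘ suc) (s≤s⁻¹ c<count)
              in (zero ∷ suc ∘ g) , zero∷suc∘-injective g-inj , λ { zero → f₀ ; (suc x) → on x }
... | false = let (g , g-inj , on) = count≥⇒embedding (suc c) (f ∘ suc) c<count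
              in suc ∘ g , g-inj ∘ suc-injective , on

¬embedding⇒count≤ : ∀ {n} c (f : Fin n → Bool) →
  (∀ (g : Fin (suc c) → Fin n) → Injective _≡_ _≡_ g → ¬ (∀ x → f (g x) ≡ true)) →
  count f ≤ c
¬embedding⇒count≤ c f none with suc c ≤? count f
... | yes c<count = let (g , g-inj , on) = count≥⇒embedding (suc c) f c<count
                    in contradiction on (none g g-inj)
... | no  c≮count = s≤s⁻¹ (≰⇒> c≮count)

C2-suc : ∀ n → suc n C 2 ≡ n + n C 2
C2-suc n = trans (sym (nCk+nC[k+1]≡[n+1]C[k+1] n 1)) (cong (_+ n C 2) (nC1≡n n))

module Plane {q : ℕ} (Π : ProjectivePlane q) where
  open ProjectivePlane Π

  infix 4 _⊆_
  infixr 6 _∪_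

  _⊆_ : PointSet Π → PointSet Π → Set
  X ⊆ Y = ∀ P → X P ≡ true → Y P ≡ true

  _∪_ : PointSet Π → PointSet Π → PointSet Π
  (X ∪ Y) P = X P ∨ Y P

  onAtLeast : ∀ {n} → ℕ → (Fin n → Ln Π) → PointSet Π
  onAtLeast c G P = c ≤ᵇ count (λ j → inc P (G j))

  onAtLeast-intro : ∀ {n c} (G : Fin n → Ln Π) P → c ≤ count (λ j → inc P (G j)) →
    onAtLeast c G P ≡ true
  onAtLeast-intro G P c≤ = Equivalence.to T-≡ (≤⇒≤ᵇ c≤)

  onAtLeast1-∷ : ∀ {n} ℓ (G : Fin n → Ln Π) P → onAtLeast 1 (ℓ ∷ G) P ≡ inc P ℓ ∨ onAtLeast 1 G P
  onAtLeast1-∷ ℓ G P with inc P ℓ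
  ... | true  = refl
  ... | false = refl

  onAtLeast2-suc : ∀ {n} (G : Fin (suc n) → Ln Π) P →
    onAtLeast 2 G P ≡ (if inc P (G zero) then onAtLeast 1 (G ∘ suc) P else onAtLeast 2 (G ∘ suc) P)
  onAtLeast2-suc G P with inc P (G zero)
  ... | true  = refl
  ... | false = refl

  meetCount-mono : ∀ {X Y} → X ⊆ Y → ∀ l → meetCount Π X l ≤ meetCount Π Y l
  meetCount-mono {X} {Y} X⊆Y l = count-mono on-l
    where
    on-l : ∀ P → inc P l ∧ X P ≡ true → inc P l ∧ Y P ≡ true
    on-l P _ with inc P l | X P in P∈X
    ... | true | true rewrite X⊆Y P P∈X = refl

  meetCount≤q+1 : ∀ X l → meetCount Π X l ≤ q + 1
  meetCount≤q+1 X l = ≤-trans (count-mono on-l) (≤-reflexive (line-size l))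
    where
    on-l : ∀ P → inc P l ∧ X P ≡ true → inc P l ≡ true
    on-l P _ with inc P l
    ... | true = refl

  meetCount-full : ∀ {X} → (∀ P → X P ≡ true) → ∀ l → meetCount Π X l ≡ q + 1
  meetCount-full full l =
    trans (count-cong λ P → trans (cong (inc P l ∧_) (full P)) (∧-identityʳ (inc P l))) (line-size l)

  meetCount-∪ : ∀ X Y l → meetCount Π (X ∪ Y) l ≤ meetCount Π X l + meetCount Π Y l
  meetCount-∪ X Y l = count-+-≤ _ _ _ λ P → ∧-∨-split (inc P l) (X P) (Y P)
    where
    ∧-∨-split : ∀ a b c → 𝟙 (a ∧ (b ∨ c)) ≤ 𝟙 (a ∧ b) + 𝟙 (a ∧ c)
    ∧-∨-split false _     _ = z≤n
    ∧-∨-split true  true  _ = s≤s z≤n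
    ∧-∨-split true  false _ = ≤-refl

  ∑-incidences : ∀ {n} ℓ (G : Fin n → Ln Π) → (∀ x → G x ≢ ℓ) →
    ∑[ P < q * q + q + 1 ] count (λ x → inc P ℓ ∧ inc P (G x)) ≡ n
  ∑-incidences {n} ℓ G G≢ℓ = begin
    ∑[ P < q * q + q + 1 ] count (λ x → inc P ℓ ∧ inc P (G x))  ≡⟨ count-swap (λ x P → inc P ℓ ∧ inc P (G x)) ⟨
    ∑[ x < n ] count (λ P → inc P ℓ ∧ inc P (G x))              ≡⟨ sum-cong-≗ (λ x → lines-meet ℓ (G x) (G≢ℓ x ∘ sym)) ⟩
    ∑[ x < n ] 1                                               ≡⟨ ∑-const-1 n ⟩
    n                                                          ∎
    where open ≡-Reasoning

  meetCount-onAtLeast1≤ : ∀ {n} ℓ (G : Fin n → Ln Π) → (∀ x → G x ≢ ℓ) →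
    meetCount Π (onAtLeast 1 G) ℓ ≤ n
  meetCount-onAtLeast1≤ {n} ℓ G G≢ℓ = begin
    meetCount Π (onAtLeast 1 G) ℓ                                ≡⟨ count≡∑ (λ P → inc P ℓ ∧ onAtLeast 1 G P) ⟩
    ∑[ P < q * q + q + 1 ] 𝟙 (inc P ℓ ∧ onAtLeast 1 G P)          ≤⟨ ∑-mono-≤ pointwise ⟩
    ∑[ P < q * q + q + 1 ] count (λ x → inc P ℓ ∧ inc P (G x))    ≡⟨ ∑-incidences ℓ G G≢ℓ ⟩
    n                                                            ∎
    where
    open ≤-Reasoning
    𝟙[1≤ᵇ]≤ : ∀ m → 𝟙 (1 ≤ᵇ m) ≤ m
    𝟙[1≤ᵇ]≤ zero    = z≤n
    𝟙[1≤ᵇ]≤ (suc m) = s≤s z≤n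
    pointwise : ∀ P → 𝟙 (inc P ℓ ∧ onAtLeast 1 G P) ≤ count (λ x → inc P ℓ ∧ inc P (G x))
    pointwise P with inc P ℓ
    ... | false = z≤n
    ... | true  = 𝟙[1≤ᵇ]≤ _

  n≤c*meetCount : ∀ {n} ℓ (G : Fin n → Ln Π) → (∀ x → G x ≢ ℓ) →
    ∀ c → (∀ P → inc P ℓ ≡ true → count (λ x → inc P (G x)) ≤ c) →
    ∀ Z → (∀ x P → inc P ℓ ≡ true → inc P (G x) ≡ true → Z P ≡ true) →
    n ≤ c * meetCount Π Z ℓ
  n≤c*meetCount {n} ℓ G G≢ℓ c ≤c Z G∩ℓ⊆Z = begin
    n                                                           ≡⟨ ∑-incidences ℓ G G≢ℓ ⟨
    ∑[ P < q * q + q + 1 ] count (λ x → inc P ℓ ∧ inc P (G x))   ≤⟨ ∑-mono-≤ pointwise ⟩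
    ∑[ P < q * q + q + 1 ] (c * 𝟙 (inc P ℓ ∧ Z P))               ≡⟨ *-distribˡ-sum c (λ P → 𝟙 (inc P ℓ ∧ Z P)) ⟨
    c * ∑[ P < q * q + q + 1 ] 𝟙 (inc P ℓ ∧ Z P)                 ≡⟨ cong (c *_) (count≡∑ (λ P → inc P ℓ ∧ Z P)) ⟨
    c * meetCount Π Z ℓ                                         ∎
    where
    open ≤-Reasoning
    pointwise : ∀ P → count (λ x → inc P ℓ ∧ inc P (G x)) ≤ c * 𝟙 (inc P ℓ ∧ Z P)
    pointwise P with inc P ℓ in P∈ℓ | Z P in P∈Z
    ... | false | _     = ≤-trans (≤-reflexive (count-none {n} λ _ → refl)) z≤n
    ... | true  | true  = ≤-trans (≤c P P∈ℓ) (≤-reflexive (sym (*-identityʳ c)))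
    pointwise P | true | false = ≤-trans (≤-reflexive (count-none P∉G)) z≤n
      where
      P∉G : ∀ x → inc P (G x) ≡ false
      P∉G x with inc P (G x) in P∈Gx
      ... | false = refl
      ... | true  = contradiction (trans (sym (G∩ℓ⊆Z x P P∈ℓ P∈Gx)) P∈Z) λ ()

  count-onAtLeast2≤ : ∀ {n} (G : Fin n → Ln Π) → Injective _≡_ _≡_ G →
    count (onAtLeast 2 G) ≤ n C 2
  count-onAtLeast2≤ {zero}  G _     = ≤-reflexive (count-none {f = onAtLeast 2 G} λ _ → refl)
  count-onAtLeast2≤ {suc n} G G-inj = begin
    count (onAtLeast 2 G)
      ≡⟨ count-cong (onAtLeast2-suc G) ⟩
    count (λ P → if inc P (G zero) then onAtLeast 1 G′ P else onAtLeast 2 G′ P)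
      ≤⟨ count-+-≤ _ _ _ (λ P → if-split (inc P (G zero)) _ _) ⟩
    meetCount Π (onAtLeast 1 G′) (G zero) + count (onAtLeast 2 G′)
      ≤⟨ +-mono-≤ (meetCount-onAtLeast1≤ (G zero) G′ G′≢G₀) (count-onAtLeast2≤ G′ (suc-injective ∘ G-inj)) ⟩
    n + n C 2
      ≡⟨ C2-suc n ⟨
    suc n C 2
      ∎
    where
    open ≤-Reasoning
    G′ = G ∘ suc
    G′≢G₀ : ∀ x → G′ x ≢ G zero
    G′≢G₀ x eq with G-inj eq
    ... | ()
    if-split : ∀ g a b → 𝟙 (if g then a else b) ≤ 𝟙 (g ∧ a) + 𝟙 b
    if-split true  a b = m≤m+n (𝟙 a) (𝟙 b)
    if-split false a b = ≤-refl

  module _ {k : ℕ} {L : Fin k → Ln Π} (L-gp : GeneralPosition Π k L) where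

    private
      ∧-true³ : ∀ {a b c} → a ≡ true → b ≡ true → c ≡ true → a ∧ b ∧ c ≡ true
      ∧-true³ refl refl refl = refl

      not-concurrent : ∀ {i j m} → i ≢ j → j ≢ m → i ≢ m → ∀ P →
        inc P (L i) ≡ true → inc P (L j) ≡ true → inc P (L m) ≡ true → ⊥
      not-concurrent i≢j j≢m i≢m P Pi Pj Pm =
        contradiction (trans (sym (∧-true³ Pi Pj Pm)) (proj₂ L-gp _ _ _ i≢j j≢m i≢m P)) λ ()

    concurrent≤2 : ∀ P → count (λ j → inc P (L j)) ≤ 2
    concurrent≤2 P = ¬embedding⇒count≤ 2 _ λ g g-inj on →
      not-concurrent (λ e → contradiction (g-inj e) λ ()) (λ e → contradiction (g-inj e) λ ())
                     (λ e → contradiction (g-inj e) λ ()) P (on zero) (on (suc zero)) (on (suc (suc zero)))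

    concurrent≤1 : ∀ {n} {e : Fin n → Fin k} → Injective _≡_ _≡_ e → ∀ {j} → (∀ x → e x ≢ j) →
      ∀ P → inc P (L j) ≡ true → count (λ x → inc P (L (e x))) ≤ 1
    concurrent≤1 e-inj e≢j P P∈Lj = ¬embedding⇒count≤ 1 _ λ g g-inj on →
      not-concurrent (e≢j _ ∘ sym) (λ eq → contradiction (g-inj (e-inj eq)) λ ()) (e≢j _ ∘ sym)
                     P P∈Lj (on zero) (on (suc zero))

    other-lines≤meetCount : ∀ {n} {e : Fin n → Fin k} → Injective _≡_ _≡_ e → ∀ {j} → (∀ x → e x ≢ j) →
      ∀ Z → (∀ x P → inc P (L j) ≡ true → inc P (L (e x)) ≡ true → Z P ≡ true) →
      n ≤ meetCount Π Z (L j)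
    other-lines≤meetCount {e = e} e-inj e≢j Z covered =
      subst (_ ≤_) (*-identityˡ _)
        (n≤c*meetCount _ (L ∘ e) (λ x eq → e≢j x (proj₁ L-gp _ _ eq)) 1 (concurrent≤1 e-inj e≢j) Z covered)

    lines≤2*meetCount : ∀ m → (∀ j → L j ≢ m) →
      ∀ Z → (∀ j P → inc P m ≡ true → inc P (L j) ≡ true → Z P ≡ true) →
      k ≤ 2 * meetCount Π Z m
    lines≤2*meetCount m L≢m = n≤c*meetCount m L L≢m 2 (λ P _ → concurrent≤2 P)

  line-through : ∀ P → ∃[ l ] inc P l ≡ true
  line-through P =
    let (g , _ , on) = count≥⇒embedding 1 (inc P) (subst (1 ≤_) (sym (point-deg P)) (m≤n+m 1 q))
    in g zero , on zero

  line-avoiding : ∀ {i} (L : Fin i → Ln Π) → i < q * q + q + 1 → ∃[ ℓ ] (∀ j → L j ≢ ℓ)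
  line-avoiding L i<N with any? (λ ℓ → all? (λ j → ¬? (L j ≟ ℓ)))
  ... | yes avoided = avoided
  ... | no  none    = contradiction (injective⇒≤ preimage-injective) (<⇒≱ i<N)
    where
    preimage : ∀ ℓ → ∃[ j ] L j ≡ ℓ
    preimage ℓ with any? (λ j → L j ≟ ℓ)
    ... | yes hit  = hit
    ... | no  miss = contradiction (ℓ , λ j eq → miss (j , eq)) none
    preimage-injective : Injective _≡_ _≡_ (proj₁ ∘ preimage)
    preimage-injective {ℓ} {ℓ′} eq =
      trans (sym (proj₂ (preimage ℓ))) (trans (cong L eq) (proj₂ (preimage ℓ′)))

  module Dynamics (r : ℕ) where

    step-keep : ∀ X P → X P ≡ true → step Π r X P ≡ true
    step-keep X P P∈X rewrite P∈X = refl

    step-line : ∀ X P l → inc P l ≡ true → r ≤ meetCount Π X l → step Π r X P ≡ true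
    step-line X P l P∈l rich =
      trans (cong (X P ∨_) (Equivalence.to T-≡ (fromWitness (l , l-rich)))) (∨-zeroʳ (X P))
      where
      l-rich : T (inc P l ∧ (r ≤ᵇ meetCount Π X l))
      l-rich = Equivalence.from T-∧ (Equivalence.from T-≡ P∈l , ≤⇒≤ᵇ rich)

    step-elim : ∀ X P → step Π r X P ≡ true →
      X P ≡ true ⊎ ∃[ l ] (inc P l ≡ true × r ≤ meetCount Π X l)
    step-elim X P P∈step with X P | any? (λ l → T? (inc P l ∧ (r ≤ᵇ meetCount Π X l)))
    ... | true  | _             = inj₁ refl
    ... | false | yes (l , rich) =
      let (P∈l , r≤) = Equivalence.to T-∧ rich in inj₂ (l , Equivalence.to T-≡ P∈l , ≤ᵇ⇒≤ r _ r≤)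

    step-mono : ∀ {X Y} → X ⊆ Y → step Π r X ⊆ step Π r Y
    step-mono {X} {Y} X⊆Y P P∈step with step-elim X P P∈step
    ... | inj₁ P∈X              = step-keep Y P (X⊆Y P P∈X)
    ... | inj₂ (l , P∈l , rich) = step-line Y P l P∈l (≤-trans rich (meetCount-mono X⊆Y l))

    iterate-mono : ∀ {X Y} → X ⊆ Y → ∀ s → iterate Π r s X ⊆ iterate Π r s Y
    iterate-mono X⊆Y zero    = X⊆Y
    iterate-mono X⊆Y (suc s) = step-mono (iterate-mono X⊆Y s)

    percolates-mono : ∀ {X Y} → X ⊆ Y → Percolates Π r X → Percolates Π r Y
    percolates-mono X⊆Y (s , full) = s , λ P → iterate-mono X⊆Y s P (full P)

    Closed : PointSet Π → Set
    Closed Y = step Π r Y ⊆ Y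

    rich-lines⊆⇒closed : ∀ {Y} → (∀ l → r ≤ meetCount Π Y l → ∀ P → inc P l ≡ true → Y P ≡ true) →
      Closed Y
    rich-lines⊆⇒closed {Y} rich⊆Y P P∈step with step-elim Y P P∈step
    ... | inj₁ P∈Y              = P∈Y
    ... | inj₂ (l , P∈l , rich) = rich⊆Y l rich P P∈l

    closed-percolating⇒full : ∀ {Y} → Closed Y → Percolates Π r Y → ∀ P → Y P ≡ true
    closed-percolating⇒full {Y} closed (s , full) P = iterate⊆ s P (full P)
      where
      iterate⊆ : ∀ s → iterate Π r s Y ⊆ Y
      iterate⊆ zero    = λ _ P∈Y → P∈Y
      iterate⊆ (suc s) = λ P P∈step → closed P (step-mono (iterate⊆ s) P P∈step)

  module LowerBound (r : ℕ) (r≤q+1 : r ≤ q + 1) where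
    open Dynamics r

    percolating-with-lines⇒size≥ : ∀ d {i} (L : Fin i → Ln Π) W → i + d ≡ r →
      Percolates Π r (W ∪ onAtLeast 1 L) → suc d C 2 ≤ count W
    percolating-with-lines⇒size≥ zero L W _ _ = z≤n
    percolating-with-lines⇒size≥ (suc d) {i} L W i+d≡r perc
      with any? (λ ℓ → (r ≤? meetCount Π (W ∪ onAtLeast 1 L) ℓ) ×-dec all? (λ j → ¬? (L j ≟ ℓ)))
    percolating-with-lines⇒size≥ (suc d) {i} L W i+d≡r perc | yes (ℓ , rich , fresh) = begin
      suc (suc d) C 2                 ≡⟨ C2-suc (suc d) ⟩
      suc d + suc d C 2               ≤⟨ +-mono-≤ d<meetCount (percolating-with-lines⇒size≥ d (ℓ ∷ L) W∖ℓ i+d≡r′ perc′) ⟩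
      meetCount Π W ℓ + count W∖ℓ     ≡⟨ count-+-≡ _ W∖ℓ W (λ P → split (inc P ℓ) (W P)) ⟨
      count W                         ∎
      where
      open ≤-Reasoning
      W∖ℓ : PointSet Π
      W∖ℓ P = W P ∧ not (inc P ℓ)
      split : ∀ l w → 𝟙 w ≡ 𝟙 (l ∧ w) + 𝟙 (w ∧ not l)
      split true  true  = refl
      split true  false = refl
      split false true  = refl
      split false false = refl
      i+d≡r′ : suc i + d ≡ r
      i+d≡r′ = trans (sym (+-suc i d)) i+d≡r
      d<meetCount : suc d ≤ meetCount Π W ℓ
      d<meetCount = +-cancelˡ-≤ i _ _ (begin
        i + suc d                                        ≡⟨ i+d≡r ⟩
        r                                                ≤⟨ rich ⟩
        meetCount Π (W ∪ onAtLeast 1 L) ℓ                ≤⟨ meetCount-∪ W (onAtLeast 1 L) ℓ ⟩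
        meetCount Π W ℓ + meetCount Π (onAtLeast 1 L) ℓ  ≤⟨ +-monoʳ-≤ _ (meetCount-onAtLeast1≤ ℓ L fresh) ⟩
        meetCount Π W ℓ + i                              ≡⟨ +-comm _ i ⟩
        i + meetCount Π W ℓ                              ∎)
      shift : ∀ w l u → w ∨ u ≡ true → (w ∧ not l) ∨ (l ∨ u) ≡ true
      shift true  true  _ _      = refl
      shift true  false _ _      = refl
      shift false l     _ u≡true = trans (cong (l ∨_) u≡true) (∨-zeroʳ l)
      perc′ : Percolates Π r (W∖ℓ ∪ onAtLeast 1 (ℓ ∷ L))
      perc′ = percolates-mono (λ P P∈ → subst (λ b → W∖ℓ P ∨ b ≡ true) (sym (onAtLeast1-∷ ℓ L P))
                                                (shift (W P) (inc P ℓ) _ P∈)) perc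
    percolating-with-lines⇒size≥ (suc d) {i} L W i+d≡r perc | no none =
      contradiction (ℓ , ℓ-rich , ℓ-fresh) none
      where
      Y = W ∪ onAtLeast 1 L
      rich⊆Y : ∀ l → r ≤ meetCount Π Y l → ∀ P → inc P l ≡ true → Y P ≡ true
      rich⊆Y l rich P P∈l with any? (λ j → L j ≟ l)
      ... | yes (j , refl) = trans (cong (W P ∨_) (onAtLeast-intro L P (count-pos {f = λ j → inc P (L j)} P∈l)))
                                   (∨-zeroʳ (W P))
      ... | no  miss       = contradiction (l , rich , λ j eq → miss (j , eq)) none
      i<N : i < q * q + q + 1
      i<N = begin-strict
        i                 <⟨ m<m+n i (s≤s z≤n) ⟩
        i + suc d         ≡⟨ i+d≡r ⟩
        r                 ≤⟨ r≤q+1 ⟩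
        q + 1             ≤⟨ m≤n+m (q + 1) (q * q) ⟩
        q * q + (q + 1)   ≡⟨ +-assoc (q * q) q 1 ⟨
        q * q + q + 1     ∎
        where open ≤-Reasoning
      ℓ = proj₁ (line-avoiding L i<N)
      ℓ-fresh = proj₂ (line-avoiding L i<N)
      ℓ-rich : r ≤ meetCount Π Y ℓ
      Y-full : ∀ P → Y P ≡ true
      Y-full = closed-percolating⇒full (rich-lines⊆⇒closed rich⊆Y) perc
      ℓ-rich = subst (r ≤_) (sym (meetCount-full Y-full ℓ)) r≤q+1

    percolating⇒size≥ : ∀ A → Percolates Π r A → suc r C 2 ≤ count A
    percolating⇒size≥ A perc = percolating-with-lines⇒size≥ r (λ ()) A refl (percolates-mono A⊆A∪∅ perc)
      where
      A⊆A∪∅ : A ⊆ A ∪ onAtLeast {0} 1 (λ ())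
      A⊆A∪∅ P P∈A rewrite P∈A = refl

  module Construction {k r : ℕ} (L : Fin k → Ln Π) (L-gp : GeneralPosition Π k L)
                      (r<k : r < k) (2r≤k : 2 * r ≤ k) where
    open Dynamics r

    ι : Fin (suc r) → Fin k
    ι i = inject≤ i r<k

    ι-injective : Injective _≡_ _≡_ ι
    ι-injective = inject≤-injective r<k r<k _ _

    F : Fin (suc r) → Ln Π
    F = L ∘ ι

    A : PointSet Π
    A = onAtLeast 2 F

    A-size : count A ≤ suc r C 2
    A-size = count-onAtLeast2≤ F (ι-injective ∘ proj₁ L-gp _ _)

    r≤meetCount-A : ∀ i → r ≤ meetCount Π A (F i)
    r≤meetCount-A i = other-lines≤meetCount L-gp (punchIn-injective i _ _ ∘ ι-injective)
      (λ x eq → punchInᵢ≢i i x (ι-injective eq)) A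
      (λ x P P∈Fi P∈Fx →
         onAtLeast-intro F P (count-pair {f = λ j → inc P (F j)} (punchInᵢ≢i i x ∘ sym) P∈Fi P∈Fx))

    r≤q+1 : r ≤ q + 1
    r≤q+1 = ≤-trans (r≤meetCount-A zero) (meetCount≤q+1 A (F zero))

    F-infected : ∀ i P → inc P (F i) ≡ true → iterate Π r 1 A P ≡ true
    F-infected i P P∈Fi = step-line A P (F i) P∈Fi (r≤meetCount-A i)

    L-infected : ∀ j P → inc P (L j) ≡ true → iterate Π r 2 A P ≡ true
    L-infected j P P∈Lj with any? (λ i → ι i ≟ j)
    ... | yes (i , refl) = step-keep _ P (F-infected i P P∈Lj)
    ... | no  j∉ι       = step-line _ P (L j) P∈Lj (≤-trans (n≤1+n r)
            (other-lines≤meetCount L-gp ι-injective (λ i eq → j∉ι (i , eq)) _ (λ i Q _ → F-infected i Q)))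

    all-infected : ∀ P → iterate Π r 3 A P ≡ true
    all-infected P with any? (λ j → T? (inc P (L j)))
    ... | yes (j , P∈Lj) = step-keep _ P (L-infected j P (Equivalence.to T-≡ P∈Lj))
    ... | no  P∉L        = step-line _ P m P∈m
            (*-cancelˡ-≤ 2 (≤-trans 2r≤k (lines≤2*meetCount L-gp m m∉L _ (λ j Q _ → L-infected j Q))))
      where
      m = proj₁ (line-through P)
      P∈m = proj₂ (line-through P)
      m∉L : ∀ j → L j ≢ m
      m∉L j eq = P∉L (j , Equivalence.from T-≡ (subst (λ l → inc P l ≡ true) (sym eq) P∈m))

    A-percolates : Percolates Π r A
    A-percolates = 3 , all-infected

proposition7 : (q : ℕ) → q ≥ 2 → (Π : ProjectivePlane q) → (r : ℕ) → r ≥ 1 →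
    (k : ℕ) → k ≥ 2 * r → (∃[ L ] GeneralPosition Π k L) →
    IsMinPercolatingSize Π r (suc r C 2)
proposition7 q _ Π r r≥1 k 2r≤k (L , L-gp) =
  (A , A-percolates , ≤-antisym A-size (percolating⇒size≥ A A-percolates)) , percolating⇒size≥
  where
  open Plane Π
  r<k : r < k
  r<k = ≤-trans (m<m+n r (≤-trans r≥1 (m≤m+n r 0))) 2r≤k
  open Construction L L-gp r<k 2r≤k
  open LowerBound r r≤q+1
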